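{- Let $(S,B)$ be a monoid with tests such that $S$ is a twisted agreeable semigroup and $B\subseteq D(S)$, where $D(s):=s*s$. Then the quasi-identity $$D(s\beta)t=D(s\beta)u\ \text{ and }\ D(s\beta')t=D(s\beta')u\ \Rightarrow\ D(s)t=D(s)u\qquad(s,t,u\in S,\ \beta\in B)$$ holds in $(S,B)$ if and only if the quasi-identity $$D(s\beta)\le \mathsf e\ \text{ and }\ D(s\beta')\le \mathsf e\ \Rightarrow\ D(s)\le \mathsf e\qquad(s\in S,\ \beta\in B,\ \mathsf e\in D(S))$$ holds.
   Context: A monoid with tests is a pair $(S,B)$ where $S$ is a monoid with identity $1$ and zero $0$, and $B\subseteq S$ is a commutative submonoid of idempotents containing $0$ with a unary operation $'$ making $(B,\cdot,{}',0,1)$ a Boolean algebra with meet the multiplication. A twisted agreeable semigroup is a semigroup with a binary operation $*$ satisfying for all $s,t,u,v$: $(s*s)s=s$; $s*t=t*s$; $(s*t)s=(s*t)t$; $((u*v)s)*t=(s*t)(u*v)$; $u(s*t)=(us*ut)u$. With $D(s):=s*s$ it is a restriction semigroup, $D(S)=\{D(s)\mid s\in S\}$, and $\mathsf e\le\mathsf f$ in $D(S)$ means $\mathsf e=\mathsf e\mathsf f$. -}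

module Defs where

open import Level using (Level; _⊔_; suc)
open import Relation.Binary.PropositionalEquality using (_≡_)
open import Data.Product using (Σ; ∃; _×_; _,_)

-- The subset B ⊆ S is a predicate IsTest;
-- the complement ' and the Boolean join ∨ are operations on B-elements
-- (given as operations on S restricted to tests).
record TwistedAgreeableMonoidWithTests (a : Level) : Set (suc a) where
  infixl 7 _·_
  field
    S      : Set a
    _·_    : S → S → S
    one    : S
    zero   : S
    assoc  : ∀ x y z → (x · y) · z ≡ x · (y · z)
    identityˡ : ∀ x → one · x ≡ x
    identityʳ : ∀ x → x · one ≡ x
    zeroˡ  : ∀ x → zero · x ≡ zero
    zeroʳ  : ∀ x → x · zero ≡ zero
    IsTest : S → Set a
    test-0 : IsTest zero
    test-1 : IsTest one
    test-· : ∀ {x y} → IsTest x → IsTest y → IsTest (x · y)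
    test-idem : ∀ {x} → IsTest x → x · x ≡ x
    test-comm : ∀ {x y} → IsTest x → IsTest y → x · y ≡ y · x
    _′     : (x : S) → S
    _∨_    : S → S → S
    test-′ : ∀ {x} → IsTest x → IsTest (x ′)
    test-∨ : ∀ {x y} → IsTest x → IsTest y → IsTest (x ∨ y)
    ∨-assoc : ∀ {x y z} → IsTest x → IsTest y → IsTest z → (x ∨ y) ∨ z ≡ x ∨ (y ∨ z)
    ∨-comm  : ∀ {x y} → IsTest x → IsTest y → x ∨ y ≡ y ∨ x
    absorb₁ : ∀ {x y} → IsTest x → IsTest y → x ∨ (x · y) ≡ x
    absorb₂ : ∀ {x y} → IsTest x → IsTest y → x · (x ∨ y) ≡ x
    distrib : ∀ {x y z} → IsTest x → IsTest y → IsTest z → x · (y ∨ z) ≡ (x · y) ∨ (x · z)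
    compl-· : ∀ {x} → IsTest x → x · (x ′) ≡ zero
    compl-∨ : ∀ {x} → IsTest x → x ∨ (x ′) ≡ one
    _*_    : S → S → S
    ta1 : ∀ s → (s * s) · s ≡ s
    ta2 : ∀ s t → s * t ≡ t * s
    ta3 : ∀ s t → (s * t) · s ≡ (s * t) · t
    ta4 : ∀ s t u v → ((u * v) · s) * t ≡ (s * t) · (u * v)
    ta5 : ∀ s t u → u · (s * t) ≡ ((u · s) * (u · t)) · u

  D : S → S
  D s = s * s

  InD : S → Set a
  InD e = ∃ λ s → e ≡ D s

  _≤D_ : S → S → Set a
  e ≤D f = e ≡ e · f


TestsInD : ∀ {a} → TwistedAgreeableMonoidWithTests a → Set a
TestsInD M = ∀ b → IsTest b → InD b
  where open TwistedAgreeableMonoidWithTests M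

QI₁ : ∀ {a} → TwistedAgreeableMonoidWithTests a → Set a
QI₁ M = ∀ s t u β → IsTest β →
        D (s · β) · t ≡ D (s · β) · u →
        D (s · (β ′)) · t ≡ D (s · (β ′)) · u →
        D s · t ≡ D s · u
  where open TwistedAgreeableMonoidWithTests M

QI₂ : ∀ {a} → TwistedAgreeableMonoidWithTests a → Set a
QI₂ M = ∀ s β e → IsTest β → InD e →
        D (s · β) ≤D e → D (s · (β ′)) ≤D e → D s ≤D e
  where open TwistedAgreeableMonoidWithTests M

-- Every agreement t * u is a projection, and a projection f with f t = f u satisfies
-- f D(t) ≤ t * u.  So QI₂, applied to D(t) s and e = t * u, turns the premises of QI₁
-- into D(s) D(t) ≤ t * u, whence D(s) t = D(s) D(t) u; the same with t and u swapped
-- gives D(s) t = D(s) u.  Conversely, QI₂ is the instance t = e, u = 1 of QI₁.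
module Submission where

open import Defs
open import Level using (Level)
open import Function.Bundles using (_⇔_; mk⇔)
open import Data.Product using (∃₂; _,_)
open import Relation.Binary.PropositionalEquality
open ≡-Reasoning

module _ {a : Level} (M : TwistedAgreeableMonoidWithTests a) where
  open TwistedAgreeableMonoidWithTests M

  IsAgreement : S → Set a
  IsAgreement x = ∃₂ λ u v → x ≡ u * v

  D-isAgreement : ∀ s → IsAgreement (D s)
  D-isAgreement s = s , s , refl

  D-one : D one ≡ one
  D-one = trans (sym (identityʳ (D one))) (ta1 one)

  agreement-*-one : ∀ {x} → IsAgreement x → x * one ≡ x
  agreement-*-one (u , v , refl) = begin
    (u * v) * one              ≡⟨ cong (_* one) (sym (identityʳ _)) ⟩
    ((u * v) · one) * one      ≡⟨ ta4 one one u v ⟩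
    D one · (u * v)            ≡⟨ cong (_· (u * v)) D-one ⟩
    one · (u * v)              ≡⟨ identityˡ _ ⟩
    u * v                      ∎

  agreement-*-agreement : ∀ {x y} → IsAgreement x → IsAgreement y → x * y ≡ y · x
  agreement-*-agreement {y = y} (u , v , refl) isY = begin
    (u * v) * y                ≡⟨ cong (_* y) (sym (identityʳ _)) ⟩
    ((u * v) · one) * y        ≡⟨ ta4 one y u v ⟩
    (one * y) · (u * v)        ≡⟨ cong (_· (u * v)) (trans (ta2 one y) (agreement-*-one isY)) ⟩
    y · (u * v)                ∎

  agreement-comm : ∀ {x y} → IsAgreement x → IsAgreement y → x · y ≡ y · x
  agreement-comm {x} {y} isX isY = begin
    x · y                      ≡⟨ sym (agreement-*-agreement isY isX) ⟩
    y * x                      ≡⟨ ta2 y x ⟩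
    x * y                      ≡⟨ agreement-*-agreement isX isY ⟩
    y · x                      ∎

  agreement-· : ∀ {x y} → IsAgreement x → IsAgreement y → IsAgreement (x · y)
  agreement-· {x} {y} isX isY = y , x , sym (agreement-*-agreement isY isX)

  agreement-idem : ∀ {x} → IsAgreement x → x · x ≡ x
  agreement-idem {x} isX = begin
    x · x                      ≡⟨ cong (_· x) (sym (agreement-*-one isX)) ⟩
    (x * one) · x              ≡⟨ ta3 x one ⟩
    (x * one) · one            ≡⟨ cong (_· one) (agreement-*-one isX) ⟩
    x · one                    ≡⟨ identityʳ x ⟩
    x                          ∎

  D-·ˡ : ∀ {e} s → IsAgreement e → D (e · s) ≡ D s · e
  D-·ˡ {e} s isE@(u , v , refl) = begin
    D (e · s)                  ≡⟨ ta4 s (e · s) u v ⟩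
    (s * (e · s)) · e          ≡⟨ cong (_· e) (trans (ta2 s (e · s)) (ta4 s s u v)) ⟩
    (D s · e) · e              ≡⟨ assoc _ _ _ ⟩
    D s · (e · e)              ≡⟨ cong (D s ·_) (agreement-idem isE) ⟩
    D s · e                    ∎

  equalizer-·-* : ∀ {f t u} → IsAgreement f → f · t ≡ f · u → f · (t * u) ≡ D t · f
  equalizer-·-* {f} {t} {u} isF ft≡fu = begin
    f · (t * u)                ≡⟨ ta5 t u f ⟩
    ((f · t) * (f · u)) · f    ≡⟨ cong (λ z → ((f · t) * z) · f) (sym ft≡fu) ⟩
    D (f · t) · f              ≡⟨ cong (_· f) (D-·ˡ t isF) ⟩
    (D t · f) · f              ≡⟨ assoc _ _ _ ⟩
    D t · (f · f)              ≡⟨ cong (D t ·_) (agreement-idem isF) ⟩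
    D t · f                    ∎

  equalizer-·D-≤ : ∀ {f t u} → IsAgreement f → f · t ≡ f · u → (f · D t) ≤D (t * u)
  equalizer-·D-≤ {f} {t} {u} isF ft≡fu = sym (begin
    (f · D t) · (t * u)        ≡⟨ cong (_· (t * u)) (agreement-comm isF isDt) ⟩
    (D t · f) · (t * u)        ≡⟨ assoc _ _ _ ⟩
    D t · (f · (t * u))        ≡⟨ cong (D t ·_) (equalizer-·-* isF ft≡fu) ⟩
    D t · (D t · f)            ≡⟨ sym (assoc _ _ _) ⟩
    (D t · D t) · f            ≡⟨ cong (_· f) (agreement-idem isDt) ⟩
    D t · f                    ≡⟨ agreement-comm isDt isF ⟩
    f · D t                    ∎)
    where isDt = D-isAgreement t

  ≤-*-equalizes : ∀ {e t u} → e ≤D (t * u) → e · t ≡ e · u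
  ≤-*-equalizes {e} {t} {u} e≤t*u = begin
    e · t                      ≡⟨ cong (_· t) e≤t*u ⟩
    (e · (t * u)) · t          ≡⟨ assoc _ _ _ ⟩
    e · ((t * u) · t)          ≡⟨ cong (e ·_) (ta3 t u) ⟩
    e · ((t * u) · u)          ≡⟨ sym (assoc _ _ _) ⟩
    (e · (t * u)) · u          ≡⟨ cong (_· u) (sym e≤t*u) ⟩
    e · u                      ∎

  agreement-InD : ∀ {x} → IsAgreement x → InD x
  agreement-InD {x} isX = x , sym (trans (agreement-*-agreement isX isX) (agreement-idem isX))

  QI₂⇒D·D-≤ : QI₂ M → ∀ s t u β → IsTest β →
              D (s · β) · t ≡ D (s · β) · u →
              D (s · (β ′)) · t ≡ D (s · (β ′)) · u →
              (D s · D t) ≤D (t * u)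
  QI₂⇒D·D-≤ qi₂ s t u β isβ eq eq′ = begin
    D s · D t                  ≡⟨ sym (D-·ˡ s isDt) ⟩
    D (D t · s)                ≡⟨ qi₂ (D t · s) β (t * u) isβ (agreement-InD (t , u , refl))
                                      (shifted β eq) (shifted (β ′) eq′) ⟩
    D (D t · s) · (t * u)      ≡⟨ cong (_· (t * u)) (D-·ˡ s isDt) ⟩
    D s · D t · (t * u)        ∎
    where
    isDt = D-isAgreement t
    D-shift : ∀ γ → D ((D t · s) · γ) ≡ D (s · γ) · D t
    D-shift γ = trans (cong D (assoc _ _ _)) (D-·ˡ (s · γ) isDt)
    shifted : ∀ γ → D (s · γ) · t ≡ D (s · γ) · u → D ((D t · s) · γ) ≤D (t * u)
    shifted γ eqγ = begin
      D ((D t · s) · γ)              ≡⟨ D-shift γ ⟩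
      D (s · γ) · D t                ≡⟨ equalizer-·D-≤ (D-isAgreement (s · γ)) eqγ ⟩
      D (s · γ) · D t · (t * u)      ≡⟨ cong (_· (t * u)) (sym (D-shift γ)) ⟩
      D ((D t · s) · γ) · (t * u)    ∎

  D·-via-D : ∀ {s t u} → D s · D t · t ≡ D s · D t · u → D s · t ≡ D s · D t · u
  D·-via-D {s} {t} {u} eq = begin
    D s · t                    ≡⟨ cong (D s ·_) (sym (ta1 t)) ⟩
    D s · (D t · t)            ≡⟨ sym (assoc _ _ _) ⟩
    D s · D t · t              ≡⟨ eq ⟩
    D s · D t · u              ∎

  QI₂⇒QI₁ : QI₂ M → QI₁ M
  QI₂⇒QI₁ qi₂ s t u β isβ eq eq′ = begin
    D s · t                    ≡⟨ D·-via-D (≤-*-equalizes (QI₂⇒D·D-≤ qi₂ s t u β isβ eq eq′)) ⟩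
    D s · D t · u              ≡⟨ cong (_· u) (agreement-comm isDs isDt) ⟩
    D t · D s · u              ≡⟨ assoc _ _ _ ⟩
    D t · (D s · u)            ≡⟨ cong (D t ·_) Dsu≡DsDut ⟩
    D t · (D s · D u · t)      ≡⟨ sym (assoc _ _ _) ⟩
    D t · (D s · D u) · t      ≡⟨ cong (_· t) (agreement-comm isDt (agreement-· isDs isDu)) ⟩
    D s · D u · D t · t        ≡⟨ assoc _ _ _ ⟩
    D s · D u · (D t · t)      ≡⟨ cong (D s · D u ·_) (ta1 t) ⟩
    D s · D u · t              ≡⟨ sym Dsu≡DsDut ⟩
    D s · u                    ∎
    where
    isDs = D-isAgreement s
    isDt = D-isAgreement t
    isDu = D-isAgreement u
    Dsu≡DsDut : D s · u ≡ D s · D u · t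
    Dsu≡DsDut = D·-via-D (≤-*-equalizes
      (QI₂⇒D·D-≤ qi₂ s u t β isβ (sym eq) (sym eq′)))

  QI₁⇒QI₂ : QI₁ M → QI₂ M
  QI₁⇒QI₂ qi₁ s β e isβ _ le le′ =
    trans (sym (identityʳ _)) (sym (qi₁ s e one β isβ (unit le) (unit le′)))
    where
    unit : ∀ {f} → f ≡ f · e → f · e ≡ f · one
    unit f≤e = trans (sym f≤e) (sym (identityʳ _))

proposition2p13 : ∀ {a : Level} (M : TwistedAgreeableMonoidWithTests a) →
    TestsInD M → (QI₁ M ⇔ QI₂ M)
proposition2p13 M _ = mk⇔ (QI₁⇒QI₂ M) (QI₂⇒QI₁ M)
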